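{- Let $G$ be a graph, $T\subseteq V(G)$ with $|T|=2$, $\gamma:E(G)\to\mathrm{GF}(2)^t$ and $\alpha\in\mathrm{GF}(2)^t$. If $\tilde w_T(\alpha)$ is finite, then $\tilde w_T(\alpha)\le 2^t|V(G)|$.
   Context: A $T$-join is a set $J\subseteq E(G)$ such that $T$ is exactly the set of odd-degree vertices of the spanning subgraph $(V(G),J)$. $\tilde w_T(\beta)$ denotes the minimum size of a $T$-join $J$ with $\gamma(J)=\sum_{e\in J}\gamma(e)=\beta$, and is $\infty$ if no such $T$-join exists. -}

module Defs where

open import Data.Nat using (ℕ; _+_; _%_)
open import Data.Bool using (Bool; true; false; _xor_; if_then_else_)
open import Data.Fin using (Fin; _≟_)
open import Data.Fin.Subset using (Subset; _∈_; ∣_∣)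
open import Data.Vec using (Vec; replicate; zipWith; lookup; tabulate; foldr; sum)
open import Data.Product using (_×_; proj₁; proj₂)
open import Relation.Nullary using (does)
open import Relation.Binary.PropositionalEquality using (_≡_)
open import Function.Bundles using (_⇔_)

-- A finite (multi)graph: vertices Fin n, edges Fin m, each edge has two
-- ends (parallel edges and loops allowed; a loop counts 2 towards degree).
record Graph : Set where
  field
    n    : ℕ
    m    : ℕ
    ends : Fin m → Fin n × Fin n
open Graph public

GF2^ : ℕ → Set
GF2^ t = Vec Bool t

_⊕_ : ∀ {t} → GF2^ t → GF2^ t → GF2^ t
_⊕_ = zipWith _xor_

𝟘 : ∀ {t} → GF2^ t
𝟘 = replicate _ false

[_] : Bool → ℕ
[ b ] = if b then 1 else 0

endsAt : (G : Graph) → Fin (m G) → Fin (n G) → ℕ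
endsAt G e v = [ does (proj₁ (ends G e) ≟ v) ] + [ does (proj₂ (ends G e) ≟ v) ]

deg : (G : Graph) → Subset (m G) → Fin (n G) → ℕ
deg G J v = sum (tabulate λ e → if lookup J e then endsAt G e v else 0)

Odd : ℕ → Set
Odd k = k % 2 ≡ 1

IsTJoin : (G : Graph) → Subset (n G) → Subset (m G) → Set
IsTJoin G T J = ∀ v → (v ∈ T) ⇔ Odd (deg G J v)

label : ∀ {t} (G : Graph) → (Fin (m G) → GF2^ t) → Subset (m G) → GF2^ t
label G γ J = foldr _ _⊕_ 𝟘 (tabulate λ e → if lookup J e then γ e else 𝟘)

-- J is a T-join with γ(J) = β  (so w̃_T(β) = min { ∣ J ∣ : TJoinWith … J })
TJoinWith : ∀ {t} (G : Graph) → Subset (n G) → (Fin (m G) → GF2^ t) → GF2^ t → Subset (m G) → Set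
TJoinWith G T γ β J = IsTJoin G T J × label G γ J ≡ β

-- If a T-join J with γ(J) = α has more than |V| + t edges, then the vectors
-- (parities of the ends of e, γ(e)) ∈ GF(2)^(|V|+t), e ∈ J, are linearly
-- dependent.  A nonempty dependent set Z ⊆ J meets every vertex an even number
-- of times and has γ(Z) = 0, so J ─ Z is again a T-join with label α, and it is
-- smaller.  Hence some such T-join has at most |V| + t ≤ 2^t |V| edges, using
-- |V| ≥ |T| = 2.
module Submission where

open import Defs

open import Algebra.Bundles using (CommutativeMonoid; CommutativeRing)
open import Data.Bool using (Bool; true; false; not; _xor_; _∧_; if_then_else_; _≟_)
open import Data.Bool.Properties using (xor-∧-commutativeRing; if-float; ∧-identityʳ; xor-same; xor-identityʳ; ¬-not)
open import Data.Nat using (ℕ; zero; suc; _+_; _*_; _^_; _%_; _<_; _≤_; _≤?_; z≤n; s≤s; s<s⁻¹)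
open import Data.Nat.Properties using (<-trans; n<1+n; ≤-refl; ≤-trans; ≰⇒>; +-mono-≤; +-monoʳ-≤; +-identityʳ; *-suc; *-comm; *-monoʳ-≤; m≤n*m; m^n>0; module ≤-Reasoning)
open import Data.Nat.Induction using (<-wellFounded)
open import Induction.WellFounded using (Acc; acc)
open import Data.Fin using (Fin; zero; suc; _↑ˡ_; _↑ʳ_)
open import Data.Fin.Properties using (any?; splitAt-↑ˡ; splitAt-↑ʳ)
open import Data.Fin.Subset using (Subset; inside; outside; _∈_; _∉_; _⊆_; _─_; _-_; _∪_; _∩_; ⁅_⁆; Empty; Nonempty; ∣_∣)
open import Data.Fin.Subset.Properties using (drop-∷-⊆; drop-∷-Empty; ∉⊥; p─⊥≡p; p─q⊆p; x∈⁅x⁆; x∈⁅y⁆⇒x≡y; x∈p∪q⁺; x∈p∪q⁻; x∈p∩q⁻; x∈p∩q⁺; _∈?_; p∩q≢∅⇒∣p─q∣<∣p∣; ∣p∣≤n)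
open import Data.Vec as Vec using (_∷_; []; lookup; here; there; tabulate)
open import Data.Vec.Properties using (lookup-zipWith; lookup-replicate; tabulate∘lookup; tabulate-cong)
open import Data.Vec.Functional using (Vector; _++_)
open import Data.Sum using (_⊎_; inj₁; inj₂; [_,_]′)
open import Data.Product using (_,_; _×_; ∃; Σ; proj₁; proj₂)
open import Relation.Nullary using (contradiction; yes; no)
open import Relation.Nullary.Decidable using (_×-dec_)
open import Function using (_∘_; _⇔_)
open import Relation.Binary.PropositionalEquality using (_≡_; refl; sym; trans; cong; cong₂; subst; module ≡-Reasoning)

module SubsetSum {c ℓ} (M : CommutativeMonoid c ℓ) where

  open CommutativeMonoid M renaming (refl to ≈-refl; sym to ≈-sym; trans to ≈-trans)
  open import Algebra.Properties.CommutativeMonoid.Sum M public using (sum; ∑-distrib-+; sum-cong-≋)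

  select : Bool → Carrier → Carrier
  select b x = if b then x else ε

  ∑[_]_ : ∀ {m} → Subset m → (Fin m → Carrier) → Carrier
  ∑[ Z ] f = sum (λ e → select (lookup Z e) (f e))

  ∑-vanish : ∀ {m} {Z : Subset m} (f : Fin m → Carrier) → (∀ {e} → e ∈ Z → f e ≈ ε) → ∑[ Z ] f ≈ ε
  ∑-vanish {Z = []}          f f≈ε = ≈-refl
  ∑-vanish {Z = inside ∷ Z}  f f≈ε = ≈-trans (∙-cong (f≈ε here) (∑-vanish (f ∘ suc) (f≈ε ∘ there))) (identityˡ ε)
  ∑-vanish {Z = outside ∷ Z} f f≈ε = ≈-trans (identityˡ _) (∑-vanish (f ∘ suc) (f≈ε ∘ there))

  ∑-⁅⁆ : ∀ {m} (w : Fin m) (f : Fin m → Carrier) → ∑[ ⁅ w ⁆ ] f ≈ f w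
  ∑-⁅⁆ zero    f = ≈-trans (∙-congˡ (∑-vanish (f ∘ suc) (λ e∈⊥ → contradiction e∈⊥ ∉⊥))) (identityʳ (f zero))
  ∑-⁅⁆ (suc w) f = ≈-trans (identityˡ _) (∑-⁅⁆ w (f ∘ suc))

  select-─ : ∀ {m} {J Z : Subset m} → Z ⊆ J → ∀ e x →
             select (lookup J e) x ≈ select (lookup (J ─ Z) e) x ∙ select (lookup Z e) x
  select-─ {J = _ ∷ _}       {_ ∷ _}       Z⊆J (suc e) x = select-─ (drop-∷-⊆ Z⊆J) e x
  select-─ {J = inside ∷ _}  {inside ∷ _}  _   zero    x = ≈-sym (identityˡ x)
  select-─ {J = inside ∷ _}  {outside ∷ _} _   zero    x = ≈-sym (identityʳ x)
  select-─ {J = outside ∷ _} {outside ∷ _} _   zero    x = ≈-sym (identityˡ ε)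
  select-─ {J = outside ∷ _} {inside ∷ _}  Z⊆J zero    x = contradiction (Z⊆J here) λ ()

  select-∪ : ∀ {m} {p q : Subset m} → Empty (p ∩ q) → ∀ e x →
             select (lookup (p ∪ q) e) x ≈ select (lookup p e) x ∙ select (lookup q e) x
  select-∪ {p = _ ∷ _}       {_ ∷ _}       disj (suc e) x = select-∪ (drop-∷-Empty disj) e x
  select-∪ {p = inside ∷ _}  {inside ∷ _}  disj zero    x = contradiction (zero , here) disj
  select-∪ {p = inside ∷ _}  {outside ∷ _} _    zero    x = ≈-sym (identityʳ x)
  select-∪ {p = outside ∷ _} {inside ∷ _}  _    zero    x = ≈-sym (identityˡ x)
  select-∪ {p = outside ∷ _} {outside ∷ _} _    zero    x = ≈-sym (identityˡ ε)

  ∑-distrib : ∀ {m} {Z : Subset m} (f g : Fin m → Carrier) → ∑[ Z ] (λ e → f e ∙ g e) ≈ ∑[ Z ] f ∙ ∑[ Z ] g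
  ∑-distrib {Z = Z} f g = ≈-trans (sum-cong-≋ (λ e → select-∙ (lookup Z e)))
    (∑-distrib-+ (λ e → select (lookup Z e) (f e)) (λ e → select (lookup Z e) (g e)))
    where
    select-∙ : ∀ b {x y} → select b (x ∙ y) ≈ select b x ∙ select b y
    select-∙ true  = ≈-refl
    select-∙ false = ≈-sym (identityˡ ε)

  ∑-─ : ∀ {m} {J Z : Subset m} → Z ⊆ J → ∀ f → ∑[ J ] f ≈ ∑[ J ─ Z ] f ∙ ∑[ Z ] f
  ∑-─ {J = J} {Z} Z⊆J f = ≈-trans (sum-cong-≋ (λ e → select-─ Z⊆J e (f e)))
    (∑-distrib-+ (λ e → select (lookup (J ─ Z) e) (f e)) (λ e → select (lookup Z e) (f e)))

  ∑-∪ : ∀ {m} {p q : Subset m} → Empty (p ∩ q) → ∀ f → ∑[ p ∪ q ] f ≈ ∑[ p ] f ∙ ∑[ q ] f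
  ∑-∪ {p = p} {q} disj f = ≈-trans (sum-cong-≋ (λ e → select-∪ disj e (f e)))
    (∑-distrib-+ (λ e → select (lookup p e) (f e)) (λ e → select (lookup q e) (f e)))

∣p∣>0⇒Nonempty : ∀ {m} {p : Subset m} → 0 < ∣ p ∣ → Nonempty p
∣p∣>0⇒Nonempty {p = inside ∷ p}  _      = zero , here
∣p∣>0⇒Nonempty {p = outside ∷ p} 0<∣p∣ with e , e∈p ← ∣p∣>0⇒Nonempty 0<∣p∣ = suc e , there e∈p

x∈p⇒suc∣p-x∣≡∣p∣ : ∀ {m} {p : Subset m} {x} → x ∈ p → suc ∣ p - x ∣ ≡ ∣ p ∣
x∈p⇒suc∣p-x∣≡∣p∣ {p = inside ∷ p}  here        = cong (suc ∘ ∣_∣) (p─⊥≡p p)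
x∈p⇒suc∣p-x∣≡∣p∣ {p = inside ∷ p}  (there x∈p) = cong suc (x∈p⇒suc∣p-x∣≡∣p∣ x∈p)
x∈p⇒suc∣p-x∣≡∣p∣ {p = outside ∷ p} (there x∈p) = x∈p⇒suc∣p-x∣≡∣p∣ x∈p

x∉p-x : ∀ {m} (p : Subset m) x → x ∉ p - x
x∉p-x (_ ∷ p) zero    ()
x∉p-x (_ ∷ p) (suc x) (there x∈p-x) = x∉p-x p x x∈p-x

x∈p⇒⁅x⁆⊆p : ∀ {m} {p : Subset m} {x} → x ∈ p → ⁅ x ⁆ ⊆ p
x∈p⇒⁅x⁆⊆p {x = x} x∈p y∈⁅x⁆ = subst (_∈ _) (sym (x∈⁅y⁆⇒x≡y x y∈⁅x⁆)) x∈p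

open SubsetSum (CommutativeRing.+-commutativeMonoid xor-∧-commutativeRing)
  renaming (∑[_]_ to ⨁[_]_)
open import Algebra.Properties.Semiring.Sum (CommutativeRing.semiring xor-∧-commutativeRing)
  using (*-distribʳ-sum)

⨁-∧ʳ : ∀ {m} {Z : Subset m} (f : Fin m → Bool) k → ⨁[ Z ] (λ e → f e ∧ k) ≡ ⨁[ Z ] f ∧ k
⨁-∧ʳ {Z = Z} f k = trans (sum-cong-≋ (λ e → sym (if-float (_∧ k) (lookup Z e))))
                         (sym (*-distribʳ-sum k (λ e → select (lookup Z e) (f e))))

xor≡false⇒≡ : ∀ a {b} → a xor b ≡ false → a ≡ b
xor≡false⇒≡ false      eq = sym eq
xor≡false⇒≡ true {true} _ = refl

⨁-─ : ∀ {m} {J Z : Subset m} (f : Fin m → Bool) → Z ⊆ J → ⨁[ Z ] f ≡ false → ⨁[ J ─ Z ] f ≡ ⨁[ J ] f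
⨁-─ {J = J} {Z} f Z⊆J ⨁Z≡0 = begin
  ⨁[ J ─ Z ] f                ≡⟨ xor-identityʳ _ ⟨
  ⨁[ J ─ Z ] f xor false      ≡⟨ cong (⨁[ J ─ Z ] f xor_) ⨁Z≡0 ⟨
  ⨁[ J ─ Z ] f xor ⨁[ Z ] f   ≡⟨ ∑-─ Z⊆J f ⟨
  ⨁[ J ] f                    ∎
  where open ≡-Reasoning

ZeroSum : ∀ {m d} → (Fin m → Vector Bool d) → Subset m → Set
ZeroSum A Z = ∀ i → ⨁[ Z ] (λ e → A e i) ≡ false

ZeroSum-++ : ∀ {m d d′} (A : Fin m → Vector Bool d) (B : Fin m → Vector Bool d′) {Z : Subset m} →
             ZeroSum (λ e → A e ++ B e) Z → ZeroSum A Z × ZeroSum B Z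
ZeroSum-++ {m} {d} {d′} A B {Z} zs =
    (λ i → trans (sym (sum-cong-≋ (λ e → cong (pick e) (splitAt-↑ˡ d i d′)))) (zs (i ↑ˡ d′)))
  , (λ i → trans (sym (sum-cong-≋ (λ e → cong (pick e) (splitAt-↑ʳ d d′ i)))) (zs (d ↑ʳ i)))
  where
  pick : Fin m → Fin d ⊎ Fin d′ → Bool
  pick e s = select (lookup Z e) ([ A e , B e ]′ s)

clearPivot : ∀ {m d} → (Fin m → Vector Bool (suc d)) → Fin m → Fin m → Vector Bool d
clearPivot A w e i = A e (suc i) xor (A e zero ∧ A w (suc i))

ZeroSum-lift : ∀ {m d} (A : Fin m → Vector Bool (suc d)) {S : Subset m} {w} → w ∈ S → A w zero ≡ true →
               ∀ {Z} → Z ⊆ S - w → Nonempty Z → ZeroSum (clearPivot A w) Z →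
               ∃ λ Z → Z ⊆ S × Nonempty Z × ZeroSum A Z
ZeroSum-lift A {S} {w} w∈S pivot {Z} Z⊆S-w ne zs = extend c rows
  where
  open ≡-Reasoning
  c : Bool
  c = ⨁[ Z ] (λ e → A e zero)

  -- Since the cleared rows of Z sum to zero, the rows of Z sum to c times the
  -- pivot row; so Z has zero sum if c = false, and Z ∪ ⁅ w ⁆ has if c = true.
  rows : ∀ i → ⨁[ Z ] (λ e → A e i) ≡ c ∧ A w i
  rows zero    = sym (trans (cong (c ∧_) pivot) (∧-identityʳ c))
  rows (suc i) = xor≡false⇒≡ _ (begin
    ⨁[ Z ] (λ e → A e (suc i)) xor c ∧ A w (suc i)
      ≡⟨ cong (⨁[ Z ] (λ e → A e (suc i)) xor_) (⨁-∧ʳ {Z = Z} (λ e → A e zero) (A w (suc i))) ⟨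
    ⨁[ Z ] (λ e → A e (suc i)) xor ⨁[ Z ] (λ e → A e zero ∧ A w (suc i))
      ≡⟨ ∑-distrib {Z = Z} (λ e → A e (suc i)) (λ e → A e zero ∧ A w (suc i)) ⟨
    ⨁[ Z ] (λ e → clearPivot A w e i)
      ≡⟨ zs i ⟩
    false ∎)

  Z⊆S : Z ⊆ S
  Z⊆S = p─q⊆p S ⁅ w ⁆ ∘ Z⊆S-w

  Z∪⁅w⁆⊆S : Z ∪ ⁅ w ⁆ ⊆ S
  Z∪⁅w⁆⊆S e∈ with x∈p∪q⁻ Z ⁅ w ⁆ e∈
  ... | inj₁ e∈Z   = Z⊆S e∈Z
  ... | inj₂ e∈⁅w⁆ = x∈p⇒⁅x⁆⊆p w∈S e∈⁅w⁆

  disjoint : Empty (Z ∩ ⁅ w ⁆)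
  disjoint (e , e∈Z∩⁅w⁆) with e∈Z , e∈⁅w⁆ ← x∈p∩q⁻ Z ⁅ w ⁆ e∈Z∩⁅w⁆ =
    x∉p-x S w (subst (_∈ S - w) (x∈⁅y⁆⇒x≡y w e∈⁅w⁆) (Z⊆S-w e∈Z))

  extend : ∀ c → (∀ i → ⨁[ Z ] (λ e → A e i) ≡ c ∧ A w i) → ∃ λ Z → Z ⊆ S × Nonempty Z × ZeroSum A Z
  extend false sums = Z , Z⊆S , ne , sums
  extend true  sums = Z ∪ ⁅ w ⁆ , Z∪⁅w⁆⊆S , (w , x∈p∪q⁺ (inj₂ (x∈⁅x⁆ w))) , λ i → begin
    ⨁[ Z ∪ ⁅ w ⁆ ] (λ e → A e i)                     ≡⟨ ∑-∪ disjoint (λ e → A e i) ⟩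
    ⨁[ Z ] (λ e → A e i) xor ⨁[ ⁅ w ⁆ ] (λ e → A e i) ≡⟨ cong₂ _xor_ (sums i) (∑-⁅⁆ w (λ e → A e i)) ⟩
    A w i xor A w i                                  ≡⟨ xor-same (A w i) ⟩
    false                                            ∎

linearDependence : ∀ d {m} (A : Fin m → Vector Bool d) (S : Subset m) → d < ∣ S ∣ →
                   ∃ λ Z → Z ⊆ S × Nonempty Z × ZeroSum A Z
linearDependence zero A S 0<∣S∣ with w , w∈S ← ∣p∣>0⇒Nonempty 0<∣S∣ =
  ⁅ w ⁆ , x∈p⇒⁅x⁆⊆p w∈S , (w , x∈⁅x⁆ w) , λ ()
linearDependence (suc d) A S d<∣S∣ with any? (λ e → e ∈? S ×-dec A e zero ≟ true)
... | yes (w , w∈S , pivot)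
  with Z , Z⊆S-w , ne , zs ← linearDependence d (clearPivot A w) (S - w)
                               (s<s⁻¹ (subst (suc d <_) (sym (x∈p⇒suc∣p-x∣≡∣p∣ w∈S)) d<∣S∣))
  = ZeroSum-lift A w∈S pivot Z⊆S-w ne zs
... | no noPivot
  with Z , Z⊆S , ne , zs ← linearDependence d (λ e i → A e (suc i)) S (<-trans (n<1+n d) d<∣S∣)
  = Z , Z⊆S , ne , λ { zero    → ∑-vanish (λ e → A e zero) (λ e∈Z → ¬-not (noPivot ∘ (_ ,_) ∘ (Z⊆S e∈Z ,_)))
                     ; (suc i) → zs i }

odd : ℕ → Bool
odd 0             = false
odd 1             = true
odd (suc (suc k)) = odd k

odd-suc : ∀ k → odd (suc k) ≡ not (odd k)
odd-suc 0             = refl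
odd-suc 1             = refl
odd-suc (suc (suc k)) = odd-suc k

odd-+ : ∀ a b → odd (a + b) ≡ odd a xor odd b
odd-+ 0             b = refl
odd-+ 1             b = odd-suc b
odd-+ (suc (suc a)) b = odd-+ a b

k%2≡[odd-k] : ∀ k → k % 2 ≡ [ odd k ]
k%2≡[odd-k] 0             = refl
k%2≡[odd-k] 1             = refl
k%2≡[odd-k] (suc (suc k)) = k%2≡[odd-k] k

odd-sum : ∀ {m} (f : Fin m → ℕ) → odd (Vec.sum (tabulate f)) ≡ sum (odd ∘ f)
odd-sum {zero}  f = refl
odd-sum {suc m} f = trans (odd-+ (f zero) _) (cong (odd (f zero) xor_) (odd-sum (f ∘ suc)))

lookup-foldr-⊕ : ∀ {m t} (g : Fin m → GF2^ t) i →
                 lookup (Vec.foldr _ _⊕_ 𝟘 (tabulate g)) i ≡ sum (λ e → lookup (g e) i)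
lookup-foldr-⊕ {zero}  g i = lookup-replicate i false
lookup-foldr-⊕ {suc m} g i =
  trans (lookup-zipWith _xor_ i (g zero) _) (cong (lookup (g zero) i xor_) (lookup-foldr-⊕ (g ∘ suc) i))

module _ (G : Graph) where

  oddEnds : Fin (m G) → Vector Bool (n G)
  oddEnds e v = odd (endsAt G e v)

  odd-deg : ∀ J v → odd (deg G J v) ≡ ⨁[ J ] (λ e → oddEnds e v)
  odd-deg J v = trans (odd-sum (λ e → if lookup J e then endsAt G e v else 0))
                      (sum-cong-≋ (λ e → if-float odd (lookup J e)))

  lookup-label : ∀ {t} (γ : Fin (m G) → GF2^ t) J i → lookup (label G γ J) i ≡ ⨁[ J ] (λ e → lookup (γ e) i)
  lookup-label γ J i = trans (lookup-foldr-⊕ (λ e → if lookup J e then γ e else 𝟘) i) (sum-cong-≋ λ e →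
    trans (if-float (λ x → lookup x i) (lookup J e))
          (cong (if lookup J e then lookup (γ e) i else_) (lookup-replicate i false)))

  edgeVector : ∀ {t} → (Fin (m G) → GF2^ t) → Fin (m G) → Vector Bool (n G + t)
  edgeVector γ e = oddEnds e ++ lookup (γ e)

  TJoinWith-─ : ∀ {t} {T γ} {α : GF2^ t} {J Z} → Z ⊆ J → ZeroSum (edgeVector γ) Z →
                TJoinWith G T γ α J → TJoinWith G T γ α (J ─ Z)
  TJoinWith-─ {T = T} {γ} {α} {J} {Z} Z⊆J zs (isJoin , labelJ) = isJoin′ , labelJ′
    where
    open ≡-Reasoning
    evenZ : ZeroSum oddEnds Z
    evenZ = proj₁ (ZeroSum-++ oddEnds (lookup ∘ γ) {Z} zs)

    γZ≡𝟘 : ZeroSum (lookup ∘ γ) Z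
    γZ≡𝟘 = proj₂ (ZeroSum-++ oddEnds (lookup ∘ γ) {Z} zs)

    deg%2 : ∀ v → deg G (J ─ Z) v % 2 ≡ deg G J v % 2
    deg%2 v = begin
      deg G (J ─ Z) v % 2                    ≡⟨ k%2≡[odd-k] (deg G (J ─ Z) v) ⟩
      [ odd (deg G (J ─ Z) v) ]              ≡⟨ cong [_] (odd-deg (J ─ Z) v) ⟩
      [ ⨁[ J ─ Z ] (λ e → oddEnds e v) ]     ≡⟨ cong [_] (⨁-─ (λ e → oddEnds e v) Z⊆J (evenZ v)) ⟩
      [ ⨁[ J ] (λ e → oddEnds e v) ]         ≡⟨ cong [_] (odd-deg J v) ⟨
      [ odd (deg G J v) ]                    ≡⟨ k%2≡[odd-k] (deg G J v) ⟨
      deg G J v % 2                          ∎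

    isJoin′ : IsTJoin G T (J ─ Z)
    isJoin′ v = subst (λ k → v ∈ T ⇔ k ≡ 1) (sym (deg%2 v)) (isJoin v)

    labelJ′ : label G γ (J ─ Z) ≡ α
    labelJ′ = begin
      label G γ (J ─ Z)                   ≡⟨ tabulate∘lookup (label G γ (J ─ Z)) ⟨
      tabulate (lookup (label G γ (J ─ Z))) ≡⟨ tabulate-cong sameCoordinates ⟩
      tabulate (lookup (label G γ J))       ≡⟨ tabulate∘lookup (label G γ J) ⟩
      label G γ J                         ≡⟨ labelJ ⟩
      α                                   ∎
      where
      sameCoordinates : ∀ i → lookup (label G γ (J ─ Z)) i ≡ lookup (label G γ J) i
      sameCoordinates i = begin
        lookup (label G γ (J ─ Z)) i        ≡⟨ lookup-label γ (J ─ Z) i ⟩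
        ⨁[ J ─ Z ] (λ e → lookup (γ e) i)  ≡⟨ ⨁-─ (λ e → lookup (γ e) i) Z⊆J (γZ≡𝟘 i) ⟩
        ⨁[ J ] (λ e → lookup (γ e) i)      ≡⟨ lookup-label γ J i ⟨
        lookup (label G γ J) i              ∎

  TJoinWith-≤ : ∀ {t T γ} {α : GF2^ t} {J₀} → TJoinWith G T γ α J₀ →
                Σ (Subset (m G)) λ J → TJoinWith G T γ α J × ∣ J ∣ ≤ n G + t
  TJoinWith-≤ {t} {T} {γ} {α} {J₀} = shrink J₀ (<-wellFounded ∣ J₀ ∣)
    where
    shrink : ∀ J → Acc _<_ ∣ J ∣ → TJoinWith G T γ α J →
             Σ (Subset (m G)) λ J → TJoinWith G T γ α J × ∣ J ∣ ≤ n G + t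
    shrink J (acc smaller) tj with ∣ J ∣ ≤? n G + t
    ... | yes small = J , tj , small
    ... | no large
      with Z , Z⊆J , (e , e∈Z) , zs ← linearDependence (n G + t) (edgeVector γ) J (≰⇒> large)
      = shrink (J ─ Z) (smaller (p∩q≢∅⇒∣p─q∣<∣p∣ J Z (e , x∈p∩q⁺ (Z⊆J e∈Z , e∈Z))))
               (TJoinWith-─ Z⊆J zs tj)

suc-n≤2^n : ∀ n → suc n ≤ 2 ^ n
suc-n≤2^n zero    = ≤-refl
suc-n≤2^n (suc n) = +-mono-≤ (m^n>0 2 n) (subst (suc n ≤_) (sym (+-identityʳ (2 ^ n))) (suc-n≤2^n n))

m+n≤2^n*m : ∀ {m} n → 1 ≤ m → m + n ≤ 2 ^ n * m
m+n≤2^n*m {m@(suc _)} n _ = begin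
  m + n       ≤⟨ +-monoʳ-≤ m (m≤n*m n m) ⟩
  m + m * n   ≡⟨ *-suc m n ⟨
  m * suc n   ≤⟨ *-monoʳ-≤ m (suc-n≤2^n n) ⟩
  m * 2 ^ n   ≡⟨ *-comm m (2 ^ n) ⟩
  2 ^ n * m   ∎
  where open ≤-Reasoning

lemma6p5 : (G : Graph) (T : Subset (n G)) → ∣ T ∣ ≡ 2 →
           (t : ℕ) (γ : Fin (m G) → GF2^ t) (α : GF2^ t) →
           (J₀ : Subset (m G)) → TJoinWith G T γ α J₀ →
           Σ (Subset (m G)) (λ J → TJoinWith G T γ α J × ∣ J ∣ ≤ 2 ^ t * n G)
lemma6p5 G T ∣T∣≡2 t γ α J₀ tj₀ with J , tj , ∣J∣≤n+t ← TJoinWith-≤ G {J₀ = J₀} tj₀ =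
  J , tj , ≤-trans ∣J∣≤n+t (m+n≤2^n*m t 1≤n)
  where
  1≤n : 1 ≤ n G
  1≤n = ≤-trans (s≤s z≤n) (subst (_≤ n G) ∣T∣≡2 (∣p∣≤n T))
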